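{- Let $n,p$ be positive integers and $\kappa$ an $n,p$-core. Then $\mathrm{skl}(\kappa)=\#H_{n,p}(\kappa)$, where $\#$ counts elements of the multiset with multiplicity.
   Context: Partitions are identified with Young diagrams (cells $(i,j)$, row $i$ from the top, column $j$); hook length $h_\lambda(i,j)=\lambda_i-j+\lambda'_j-i+1$ with $\lambda'$ the conjugate. An $n,p$-core is a partition with no hook length equal to $n$ and none equal to $p$. Let $m$ be the hook length of the top-left cell of $\kappa$; $H^c(m)$ is the set of hook lengths of cells in the first column and $H^r(m)$ that of cells in the first row. For $h\in H^c(m)$ the row whose leftmost cell has hook length $h$ is an $n$-row if $h+n\notin H^c(m)$. For $h\in H^r(m)$ the column whose top cell has hook length $h$ is a $p$-column if $h+p\notin H^r(m)$. $H_{n,p}(\kappa)$ is the multiset of hook lengths of cells lying in both an $n$-row and a $p$-column. The skew length $\mathrm{skl}(\kappa)$ is the number of cells of $\kappa$ that lie in an $n$-row and have hook length less than $p$. -}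

module Defs where

open import Data.Nat using (ℕ; zero; suc; _+_; _∸_; _≤_; _<_; _≤?_; _<?_; _≟_)
open import Data.List using (List; []; _∷_; length; map; filter; concatMap; upTo)
open import Data.List.Relation.Unary.Linked using (Linked)
open import Data.List.Relation.Unary.All using (All)
open import Data.List.Membership.DecPropositional _≟_ using (_∈_; _∈?_)
open import Data.Product using (_×_; _,_; proj₁; proj₂)
open import Relation.Nullary using (¬_; Dec)
open import Relation.Nullary.Decidable using (_×-dec_; ¬?)
open import Relation.Binary.PropositionalEquality using (_≢_)

record Partition : Set where
  constructor mkPartition
  field
    parts      : List ℕ
    decreasing : Linked (λ a b → b ≤ a) parts
    positive   : All (λ a → 0 < a) parts
open Partition public

-- 1-indexed lookup with default 0: partAt xs i = λ_i (λ_i = 0 outside range).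
partAt : List ℕ → ℕ → ℕ
partAt []       _             = 0
partAt (x ∷ xs) zero          = 0
partAt (x ∷ xs) (suc zero)    = x
partAt (x ∷ xs) (suc (suc i)) = partAt xs (suc i)

row : Partition → ℕ → ℕ
row κ i = partAt (parts κ) i

conj : Partition → ℕ → ℕ
conj κ j = length (filter (λ a → j ≤? a) (parts κ))

nrows : Partition → ℕ
nrows κ = length (parts κ)

oneTo : ℕ → List ℕ
oneTo k = map suc (upTo k)

cells : Partition → List (ℕ × ℕ)
cells κ = concatMap (λ i → map (λ j → (i , j)) (oneTo (row κ i))) (oneTo (nrows κ))

hook : Partition → ℕ × ℕ → ℕ
hook κ (i , j) = (row κ i ∸ j) + (conj κ j ∸ i) + 1

IsCore : ℕ → ℕ → Partition → Set
IsCore n p κ = All (λ c → hook κ c ≢ n × hook κ c ≢ p) (cells κ)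

Hc : Partition → List ℕ
Hc κ = map (λ i → hook κ (i , 1)) (oneTo (nrows κ))

Hr : Partition → List ℕ
Hr κ = map (λ j → hook κ (1 , j)) (oneTo (row κ 1))

IsNRow : ℕ → Partition → ℕ → Set
IsNRow n κ i = ¬ (hook κ (i , 1) + n ∈ Hc κ)

isNRow? : ∀ n κ i → Dec (IsNRow n κ i)
isNRow? n κ i = ¬? (hook κ (i , 1) + n ∈? Hc κ)

IsPCol : ℕ → Partition → ℕ → Set
IsPCol p κ j = ¬ (hook κ (1 , j) + p ∈ Hr κ)

isPCol? : ∀ p κ j → Dec (IsPCol p κ j)
isPCol? p κ j = ¬? (hook κ (1 , j) + p ∈? Hr κ)

Hnp : ℕ → ℕ → Partition → List ℕ
Hnp n p κ = map (hook κ)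
  (filter (λ c → isNRow? n κ (proj₁ c) ×-dec isPCol? p κ (proj₂ c)) (cells κ))

skl : ℕ → ℕ → Partition → ℕ
skl n p κ = length
  (filter (λ c → isNRow? n κ (proj₁ c) ×-dec (hook κ c <? p)) (cells κ))

-- Whether a row is an n-row depends only on the row, so it suffices to show, row by row, that
-- the cells with hook < p are as many as the cells in p-columns; only "no hook equals p" is used.
-- The hooks H of row i strictly decrease along the row and avoid p. They are closed under
-- x ↦ x − p for x > p: every 0 < v < h(i,j) is either the hook of a cell to the right of (i,j)
-- or the difference h(i,j) − h(i',j) for a cell (i',j) below it, and the latter is never p.
-- Such a set has as many elements below p as elements x with x + p ∉ H. Finally, along a row
-- the hooks differ from those of the first row by a constant, so column j is a p-column
-- exactly when h(i,j) + p ∉ H.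

module Submission where

open import Defs
open import Data.Nat
open import Data.Nat.Properties
open import Data.Nat.Tactic.RingSolver using (solve-∀)
open import Data.List using (List; []; _∷_; length; map; filter; concatMap; _++_)
import Data.List.Properties as List
open import Data.List.Relation.Unary.All as All using (All; []; _∷_)
open import Data.List.Relation.Unary.Any using (here; there)
open import Data.List.Relation.Unary.AllPairs as AllPairs using (AllPairs; []; _∷_)
import Data.List.Relation.Unary.AllPairs.Properties as AllPairs
open import Data.List.Relation.Unary.Linked using (Linked; []; [-]; _∷_)
open import Data.List.Relation.Unary.Linked.Properties using (Linked⇒All)
open import Data.List.Relation.Unary.Unique.Propositional using (Unique)
open import Data.List.Membership.Propositional using (_∈_; _∉_; lose)
import Data.List.Membership.Propositional.Properties as ∈
import Data.List.Membership.DecPropositional _≟_ as ℕ∈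
open import Data.Product using (_×_; _,_; proj₁; proj₂; ∃-syntax; uncurry)
open import Data.Sum using (_⊎_; inj₁; inj₂)
open import Data.Empty using (⊥-elim)
open import Function using (_∘_)
open import Level using (0ℓ)
open import Relation.Nullary using (¬_; Dec; yes; no)
open import Relation.Nullary.Decidable using (_×-dec_; ¬?)
open import Relation.Unary using (Pred; Decidable)
open import Relation.Binary.Definitions using (DecidableEquality)
open import Relation.Binary.PropositionalEquality

private variable
  A B : Set

count : {P : Pred A 0ℓ} → Decidable P → List A → ℕ
count P? xs = length (filter P? xs)

count-accept : {P : Pred A 0ℓ} (P? : Decidable P) {x : A} (xs : List A) →
  P x → count P? (x ∷ xs) ≡ suc (count P? xs)
count-accept P? xs Px = cong length (List.filter-accept P? Px)

count-reject : {P : Pred A 0ℓ} (P? : Decidable P) {x : A} (xs : List A) →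
  ¬ P x → count P? (x ∷ xs) ≡ count P? xs
count-reject P? xs ¬Px = cong length (List.filter-reject P? ¬Px)

count-cong : {P Q : Pred A 0ℓ} (P? : Decidable P) (Q? : Decidable Q) (xs : List A) →
  All (λ x → (P x → Q x) × (Q x → P x)) xs → count P? xs ≡ count Q? xs
count-cong P? Q? [] [] = refl
count-cong P? Q? (x ∷ xs) ((P⇒Q , Q⇒P) ∷ rest) with P? x | Q? x
... | yes _   | yes _   = cong suc (count-cong P? Q? xs rest)
... | yes Px  | no ¬Qx  = ⊥-elim (¬Qx (P⇒Q Px))
... | no ¬Px  | yes Qx  = ⊥-elim (¬Px (Q⇒P Qx))
... | no _    | no _    = count-cong P? Q? xs rest

count-map : {P : Pred B 0ℓ} (P? : Decidable P) (f : A → B) (xs : List A) →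
  count P? (map f xs) ≡ count (P? ∘ f) xs
count-map P? f [] = refl
count-map P? f (x ∷ xs) with P? (f x)
... | yes _ = cong suc (count-map P? f xs)
... | no _  = count-map P? f xs

count-++ : {P : Pred A 0ℓ} (P? : Decidable P) (xs ys : List A) →
  count P? (xs ++ ys) ≡ count P? xs + count P? ys
count-++ P? xs ys = trans (cong length (List.filter-++ P? xs ys)) (List.length-++ (filter P? xs))

count-concatMap-cong : {P Q : Pred B 0ℓ} (P? : Decidable P) (Q? : Decidable Q) (f : A → List B) (xs : List A) →
  All (λ x → count P? (f x) ≡ count Q? (f x)) xs →
  count P? (concatMap f xs) ≡ count Q? (concatMap f xs)
count-concatMap-cong P? Q? f [] [] = refl
count-concatMap-cong P? Q? f (x ∷ xs) (eq ∷ eqs) = begin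
  count P? (f x ++ concatMap f xs)              ≡⟨ count-++ P? (f x) _ ⟩
  count P? (f x) + count P? (concatMap f xs)    ≡⟨ cong₂ _+_ eq (count-concatMap-cong P? Q? f xs eqs) ⟩
  count Q? (f x) + count Q? (concatMap f xs)    ≡⟨ count-++ Q? (f x) _ ⟨
  count Q? (f x ++ concatMap f xs)              ∎
  where open ≡-Reasoning

count-guard-cong : {R : Set} {P Q : Pred A 0ℓ} (R? : Dec R) (P? : Decidable P) (Q? : Decidable Q)
  (xs : List A) → count P? xs ≡ count Q? xs →
  count (λ x → R? ×-dec P? x) xs ≡ count (λ x → R? ×-dec Q? x) xs
count-guard-cong (yes r) P? Q? xs eq =
  trans (count-cong _ P? xs (All.tabulate λ _ → proj₂ , (r ,_)))
    (trans eq (count-cong Q? _ xs (All.tabulate λ _ → (r ,_) , proj₂)))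
count-guard-cong (no ¬r) P? Q? xs _ = trans (none P?) (sym (none Q?))
  where
  none : ∀ {S : Pred _ 0ℓ} (S? : Decidable S) → count (λ x → no ¬r ×-dec S? x) xs ≡ 0
  none S? = cong length (List.filter-none (λ x → no ¬r ×-dec S? x) (All.tabulate {xs = xs} λ _ → ¬r ∘ proj₁))

module _ {A : Set} (_≟ᴬ_ : DecidableEquality A) where

  count-remove : {P : Pred A 0ℓ} (P? : Decidable P) {xs : List A} {w : A} → Unique xs → w ∈ xs → P w →
    count P? xs ≡ suc (count (λ x → P? x ×-dec ¬? (x ≟ᴬ w)) xs)
  count-remove P? {_ ∷ xs} {w} (w∉xs ∷ _) (here refl) Pw = begin
    count P? (w ∷ xs)         ≡⟨ count-accept P? xs Pw ⟩
    suc (count P? xs)         ≡⟨ cong suc (count-cong P? P?≢w xs (All.map (λ w≢x → (_, w≢x ∘ sym) , proj₁) w∉xs)) ⟩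
    suc (count P?≢w xs)       ≡⟨ cong suc (count-reject P?≢w xs (λ (_ , w≢w) → w≢w refl)) ⟨
    suc (count P?≢w (w ∷ xs)) ∎
    where
    open ≡-Reasoning
    P?≢w = λ x → P? x ×-dec ¬? (x ≟ᴬ w)
  count-remove {P} P? {y ∷ xs} {w} (y∉xs ∷ uniq) (there w∈xs) Pw = by-cases (P? y)
    where
    P?≢w = λ x → P? x ×-dec ¬? (x ≟ᴬ w)
    ih = count-remove P? uniq w∈xs Pw
    by-cases : Dec (P y) → count P? (y ∷ xs) ≡ suc (count P?≢w (y ∷ xs))
    by-cases (yes Py) = trans (count-accept P? xs Py)
      (cong suc (trans ih (sym (count-accept P?≢w xs (Py , All.lookup y∉xs w∈xs)))))
    by-cases (no ¬Py) = trans (count-reject P? xs ¬Py)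
      (trans ih (cong suc (sym (count-reject P?≢w xs (¬Py ∘ proj₁)))))

-- Both sides count the maximal chains x, x + p, x + 2p, … inside xs: by closure each chain
-- reaches below p, and x + p ∉ xs marks its top.
count-<≡count-+∉ : ∀ {p} → p > 0 → {xs : List ℕ} → AllPairs _>_ xs → p ∉ xs →
  (∀ {x} → x ∈ xs → p < x → x ∸ p ∈ xs) →
  count (_<? p) xs ≡ count (λ x → x + p ℕ∈.∉? xs) xs
count-<≡count-+∉ p>0 {[]} _ _ _ = refl
count-<≡count-+∉ {p} p>0 {h ∷ t} (h>t ∷ t-dec) p∉ closed = head-case (h <? p)
  where
  top? : (ys : List ℕ) → Decidable (λ x → x + p ∉ ys)
  top? ys x = x + p ℕ∈.∉? ys

  closedᵗ : ∀ {x} → x ∈ t → p < x → x ∸ p ∈ t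
  closedᵗ {x} x∈t p<x with closed (there x∈t) p<x
  ... | here x∸p≡h  = ⊥-elim (<-irrefl x∸p≡h (≤-<-trans (m∸n≤m x p) (All.lookup h>t x∈t)))
  ... | there x∸p∈t = x∸p∈t

  ih : count (_<? p) t ≡ count (top? t) t
  ih = count-<≡count-+∉ p>0 t-dec (p∉ ∘ there) closedᵗ

  ∉t⇒∉ : ∀ {y} → h < y → y ∉ t → y ∉ h ∷ t
  ∉t⇒∉ h<y _ (here y≡h) = <-irrefl (sym y≡h) h<y
  ∉t⇒∉ _ y∉t (there y∈t) = y∉t y∈t

  h-top : h + p ∉ h ∷ t
  h-top = ∉t⇒∉ (m<m+n h p>0) (λ h+p∈t → <⇒≱ (All.lookup h>t h+p∈t) (m≤m+n h p))

  head-case : Dec (h < p) → count (_<? p) (h ∷ t) ≡ count (top? (h ∷ t)) (h ∷ t)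
  head-case (yes h<p) = begin
    count (_<? p) (h ∷ t)            ≡⟨ count-accept (_<? p) t h<p ⟩
    suc (count (_<? p) t)            ≡⟨ cong suc ih ⟩
    suc (count (top? t) t)           ≡⟨ cong suc (count-cong (top? t) (top? (h ∷ t)) t
                                                  (All.tabulate λ _ → to , _∘ there)) ⟩
    suc (count (top? (h ∷ t)) t)     ≡⟨ count-accept (top? (h ∷ t)) t h-top ⟨
    count (top? (h ∷ t)) (h ∷ t)     ∎
    where
    open ≡-Reasoning
    to : ∀ {x} → x + p ∉ t → x + p ∉ h ∷ t
    to {x} = ∉t⇒∉ (<-≤-trans h<p (m≤n+m p x))
  head-case (no h≮p) = begin
    count (_<? p) (h ∷ t)            ≡⟨ count-reject (_<? p) t h≮p ⟩
    count (_<? p) t                  ≡⟨ ih ⟩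
    count (top? t) t                 ≡⟨ count-remove _≟_ (top? t) (AllPairs.map >⇒≢ t-dec) w∈t w-top ⟩
    suc (count top-but-w t)          ≡⟨ cong suc (count-cong top-but-w (top? (h ∷ t)) t
                                                  (All.tabulate λ _ → to , from)) ⟩
    suc (count (top? (h ∷ t)) t)     ≡⟨ count-accept (top? (h ∷ t)) t h-top ⟨
    count (top? (h ∷ t)) (h ∷ t)     ∎
    where
    open ≡-Reasoning
    p<h : p < h
    p<h = ≤∧≢⇒< (≮⇒≥ h≮p) (λ p≡h → p∉ (here p≡h))
    w = h ∸ p
    w+p≡h : w + p ≡ h
    w+p≡h = m∸n+n≡m (<⇒≤ p<h)
    w∈t : w ∈ t
    w∈t with closed (here refl) p<h
    ... | here w≡h  = ⊥-elim (<-irrefl (trans (sym w+p≡h) (cong (_+ p) w≡h)) (m<m+n h p>0))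
    ... | there w∈t = w∈t
    w-top : w + p ∉ t
    w-top w+p∈t = <-irrefl w+p≡h (All.lookup h>t w+p∈t)
    top-but-w = λ x → top? t x ×-dec ¬? (x ≟ w)
    to : ∀ {x} → x + p ∉ t × x ≢ w → x + p ∉ h ∷ t
    to {x} (_ , x≢w) (here x+p≡h) = x≢w (trans (sym (m+n∸n≡m x p)) (cong (_∸ p) x+p≡h))
    to (x+p∉t , _) (there x+p∈t) = x+p∉t x+p∈t
    from : ∀ {x} → x + p ∉ h ∷ t → x + p ∉ t × x ≢ w
    from x+p∉ = x+p∉ ∘ there , λ x≡w → x+p∉ (here (trans (cong (_+ p) x≡w) w+p≡h))

end-of-run : {P : Pred ℕ 0ℓ} → Decidable P → ∀ b → P 0 →
  ∃[ t ] t ≤ b × P t × (t < b → ¬ P (suc t))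
end-of-run P? zero P0 = 0 , z≤n , P0 , λ ()
end-of-run P? (suc b) P0 with P? 1
... | no ¬P1 = 0 , z≤n , P0 , λ _ → ¬P1
... | yes P1 with end-of-run (P? ∘ suc) b P1
...   | t , t≤b , Pt , stop = suc t , s≤s t≤b , Pt , stop ∘ s≤s⁻¹

offset-transfer : ∀ a a' b b' {k k' p} → a + k ≡ a' + k' → b + k ≡ b' + k' → a + p ≡ b → a' + p ≡ b'
offset-transfer a a' b b' {k} {k'} {p} a≈a' b≈b' a+p≡b = +-cancelʳ-≡ k' _ _ (begin
  a' + p + k'  ≡⟨ swap a' p k' ⟩
  a' + k' + p  ≡⟨ cong (_+ p) a≈a' ⟨
  a + k + p    ≡⟨ swap a k p ⟩
  a + p + k    ≡⟨ cong (_+ k) a+p≡b ⟩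
  b + k        ≡⟨ b≈b' ⟩
  b' + k'      ∎)
  where
  open ≡-Reasoning
  swap : ∀ x y z → x + y + z ≡ x + z + y
  swap = solve-∀

∈-oneTo⁺ : ∀ {j k} → 1 ≤ j → j ≤ k → j ∈ oneTo k
∈-oneTo⁺ {suc j} _ j<k = ∈.∈-map⁺ suc (∈.∈-upTo⁺ j<k)

∈-oneTo⁻ : ∀ {j k} → j ∈ oneTo k → 1 ≤ j × j ≤ k
∈-oneTo⁻ j∈ with _ , j-1∈ , refl ← ∈.∈-map⁻ suc j∈ = s≤s z≤n , ∈.∈-upTo⁻ j-1∈

partAt-≤ : ∀ {x xs} → All (_≤ x) xs → ∀ k → partAt xs k ≤ x
partAt-≤ []              k             = z≤n
partAt-≤ (_ ∷ _)         zero          = z≤n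
partAt-≤ (y≤x ∷ _)       (suc zero)    = y≤x
partAt-≤ (_ ∷ ys≤x)      (suc (suc k)) = partAt-≤ ys≤x (suc k)

tail-≤-head : ∀ {x xs} → Linked _≥_ (x ∷ xs) → All (_≤ x) xs
tail-≤-head [-]          = []
tail-≤-head (x≥y ∷ rest) = Linked⇒All (λ a≥b b≥c → ≤-trans b≥c a≥b) x≥y rest

tail-linked : ∀ {x xs} → Linked _≥_ (x ∷ xs) → Linked _≥_ xs
tail-linked [-]      = []
tail-linked (_ ∷ xs) = xs

partAt-≤-head : ∀ {x xs} → Linked _≥_ (x ∷ xs) → ∀ k → partAt (x ∷ xs) k ≤ x
partAt-≤-head dec = partAt-≤ (≤-refl ∷ tail-≤-head dec)

partAt-pos : ∀ xs i → 0 < partAt xs i → 1 ≤ i × i ≤ length xs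
partAt-pos (x ∷ xs) (suc zero)    _   = s≤s z≤n , s≤s z≤n
partAt-pos (x ∷ xs) (suc (suc i)) pos = s≤s z≤n , s≤s (proj₂ (partAt-pos xs (suc i) pos))

≤-partAt⇒≤-count : ∀ {xs} → Linked _≥_ xs → ∀ k c →
  suc c ≤ partAt xs (suc k) → suc k ≤ count (suc c ≤?_) xs
≤-partAt⇒≤-count {x ∷ xs} dec k c c<xₖ with suc c ≤? x
... | no c≮x = ⊥-elim (c≮x (≤-trans c<xₖ (partAt-≤-head dec (suc k))))
... | yes c<x = subst (suc k ≤_) (sym (count-accept (suc c ≤?_) xs c<x)) (by-row k c<xₖ)
  where
  by-row : ∀ k → suc c ≤ partAt (x ∷ xs) (suc k) → suc k ≤ suc (count (suc c ≤?_) xs)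
  by-row zero    _    = s≤s z≤n
  by-row (suc k) c<xₖ = s≤s (≤-partAt⇒≤-count (tail-linked dec) k c c<xₖ)

≤-count⇒≤-partAt : ∀ {xs} → Linked _≥_ xs → ∀ k c →
  suc k ≤ count (suc c ≤?_) xs → suc c ≤ partAt xs (suc k)
≤-count⇒≤-partAt {x ∷ xs} dec k c k<count with suc c ≤? x
... | yes c<x = by-row k (subst (suc k ≤_) (count-accept (suc c ≤?_) xs c<x) k<count)
  where
  by-row : ∀ k → suc k ≤ suc (count (suc c ≤?_) xs) → suc c ≤ partAt (x ∷ xs) (suc k)
  by-row zero    _              = c<x
  by-row (suc k) (s≤s k<count) = ≤-count⇒≤-partAt (tail-linked dec) k c k<count
... | no c≮x = ⊥-elim (<⇒≱ (s≤s z≤n) (subst (suc k ≤_) count≡0 k<count))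
  where
  count≡0 : count (suc c ≤?_) (x ∷ xs) ≡ 0
  count≡0 = cong length (List.filter-none (suc c ≤?_)
    (c≮x ∷ All.map (λ y≤x c<y → c≮x (≤-trans c<y y≤x)) (tail-≤-head dec)))

module Diagram (κ : Partition) where

  ≤-row⇒≤-conj : ∀ {i j} → 1 ≤ i → 1 ≤ j → j ≤ row κ i → i ≤ conj κ j
  ≤-row⇒≤-conj {suc i} {suc j} _ _ = ≤-partAt⇒≤-count (decreasing κ) i j

  ≤-conj⇒≤-row : ∀ {i j} → 1 ≤ i → 1 ≤ j → i ≤ conj κ j → j ≤ row κ i
  ≤-conj⇒≤-row {suc i} {suc j} _ _ = ≤-count⇒≤-partAt (decreasing κ) i j

  row-antitone : ∀ {i i'} → 1 ≤ i → i ≤ i' → row κ i' ≤ row κ i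
  row-antitone {i} {i'} 1≤i i≤i' = bound ≤-refl
    where
    bound : ∀ {c} → c ≤ row κ i' → c ≤ row κ i
    bound {zero}  _        = z≤n
    bound {suc c} c<row-i' = ≤-conj⇒≤-row 1≤i (s≤s z≤n)
      (≤-trans i≤i' (≤-row⇒≤-conj (≤-trans 1≤i i≤i') (s≤s z≤n) c<row-i'))

  conj-antitone : ∀ {j j'} → 1 ≤ j → j ≤ j' → conj κ j' ≤ conj κ j
  conj-antitone {j} {j'} 1≤j j≤j' = bound ≤-refl
    where
    bound : ∀ {r} → r ≤ conj κ j' → r ≤ conj κ j
    bound {zero}  _         = z≤n
    bound {suc r} r<conj-j' = ≤-row⇒≤-conj (s≤s z≤n) 1≤j
      (≤-trans j≤j' (≤-conj⇒≤-row (s≤s z≤n) (≤-trans 1≤j j≤j') r<conj-j'))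

  row-pos : ∀ {i} → 0 < row κ i → 1 ≤ i × i ≤ nrows κ
  row-pos {i} = partAt-pos (parts κ) i

  row-index-pos : ∀ {i j} → 1 ≤ j → j ≤ row κ i → 1 ≤ i
  row-index-pos 1≤j j≤row = proj₁ (row-pos (≤-trans 1≤j j≤row))

  conj<⇒row< : ∀ {i j} → 1 ≤ j → conj κ j < i → row κ i < j
  conj<⇒row< {i} {j} 1≤j conj<i =
    ≰⇒> λ j≤row → <⇒≱ conj<i (≤-row⇒≤-conj (≤-<-trans z≤n conj<i) 1≤j j≤row)

  conj-≡ : ∀ {k c} → 1 ≤ k → c ≤ row κ k → row κ (suc k) < c → conj κ c ≡ k
  conj-≡ {k} {c} 1≤k c≤row row<c = ≤-antisym conj≤k (≤-row⇒≤-conj 1≤k 1≤c c≤row)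
    where
    1≤c = ≤-<-trans z≤n row<c
    conj≤k : conj κ c ≤ k
    conj≤k with conj κ c ≤? k
    ... | yes conj≤k = conj≤k
    ... | no  conj≰k = ⊥-elim (<⇒≱ row<c (≤-conj⇒≤-row (s≤s z≤n) 1≤c (≰⇒> conj≰k)))

  hook+i+j≡row+conj+1 : ∀ {i j} → j ≤ row κ i → i ≤ conj κ j →
    hook κ (i , j) + (i + j) ≡ row κ i + conj κ j + 1
  hook+i+j≡row+conj+1 {i} {j} j≤row i≤conj = begin
    (row κ i ∸ j) + (conj κ j ∸ i) + 1 + (i + j)   ≡⟨ regroup (row κ i ∸ j) (conj κ j ∸ i) i j ⟩
    (row κ i ∸ j + j) + (conj κ j ∸ i + i) + 1     ≡⟨ cong₂ (λ a b → a + b + 1) (m∸n+n≡m j≤row) (m∸n+n≡m i≤conj) ⟩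
    row κ i + conj κ j + 1                         ∎
    where
    open ≡-Reasoning
    regroup : ∀ a b i j → a + b + 1 + (i + j) ≡ (a + j) + (b + i) + 1
    regroup = solve-∀

  hook-strictly-decreasing-in-row : ∀ {i j j'} → 1 ≤ j → j < j' → j' ≤ row κ i → hook κ (i , j') < hook κ (i , j)
  hook-strictly-decreasing-in-row {i} 1≤j j<j' j'≤row = +-monoˡ-< 1
    (+-mono-<-≤ (∸-monoʳ-< j<j' j'≤row) (∸-monoˡ-≤ i (conj-antitone 1≤j (<⇒≤ j<j'))))

  hook-first-row-shift : ∀ {i j} → 1 ≤ i → 1 ≤ j → j ≤ row κ i →
    hook κ (1 , j) + (row κ i + 1) ≡ hook κ (i , j) + (row κ 1 + i)
  hook-first-row-shift {i} {j} 1≤i 1≤j j≤row = +-cancelʳ-≡ (i + j) _ _ (begin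
    hook κ (1 , j) + (row κ i + 1) + (i + j)    ≡⟨ regroup (hook κ (1 , j)) (row κ i) i j ⟩
    hook κ (1 , j) + (1 + j) + (row κ i + i)    ≡⟨ cong (_+ (row κ i + i)) hook₁ ⟩
    row κ 1 + conj κ j + 1 + (row κ i + i)      ≡⟨ swap (row κ 1) (conj κ j) (row κ i) i ⟩
    row κ i + conj κ j + 1 + (row κ 1 + i)      ≡⟨ cong (_+ (row κ 1 + i)) hookᵢ ⟨
    hook κ (i , j) + (i + j) + (row κ 1 + i)    ≡⟨ regroup′ (hook κ (i , j)) (row κ 1) i j ⟩
    hook κ (i , j) + (row κ 1 + i) + (i + j)    ∎)
    where
    open ≡-Reasoning
    j≤row₁ = ≤-trans j≤row (row-antitone (s≤s z≤n) 1≤i)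
    hook₁ = hook+i+j≡row+conj+1 j≤row₁ (≤-row⇒≤-conj (s≤s z≤n) 1≤j j≤row₁)
    hookᵢ = hook+i+j≡row+conj+1 j≤row (≤-row⇒≤-conj 1≤i 1≤j j≤row)
    regroup : ∀ h r i j → h + (r + 1) + (i + j) ≡ h + (1 + j) + (r + i)
    regroup = solve-∀
    swap : ∀ r₁ c rᵢ i → r₁ + c + 1 + (rᵢ + i) ≡ rᵢ + c + 1 + (r₁ + i)
    swap = solve-∀
    regroup′ : ∀ h r i j → h + (i + j) + (r + i) ≡ h + (r + i) + (i + j)
    regroup′ = solve-∀

  hook-in-column-of-length : ∀ {i t c} → 1 ≤ i → c ≤ row κ (t + i) → row κ (suc t + i) < c →
    hook κ (i , c) + c ≡ suc t + row κ i
  hook-in-column-of-length {i} {t} {c} 1≤i c≤row row<c = +-cancelʳ-≡ i _ _ (begin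
    hook κ (i , c) + c + i          ≡⟨ trans (+-assoc (hook κ (i , c)) c i) (cong (hook κ (i , c) +_) (+-comm c i)) ⟩
    hook κ (i , c) + (i + c)        ≡⟨ hook+i+j≡row+conj+1 c≤rowᵢ (≤-row⇒≤-conj 1≤i 1≤c c≤rowᵢ) ⟩
    row κ i + conj κ c + 1          ≡⟨ cong (λ r → row κ i + r + 1) (conj-≡ (≤-trans 1≤i (m≤n+m i t)) c≤row row<c) ⟩
    row κ i + (t + i) + 1           ≡⟨ regroup (row κ i) t i ⟩
    suc t + row κ i + i             ∎)
    where
    open ≡-Reasoning
    1≤c = ≤-<-trans z≤n row<c
    c≤rowᵢ = ≤-trans c≤row (row-antitone 1≤i (m≤n+m i t))
    regroup : ∀ r t i → r + (t + i) + 1 ≡ suc t + r + i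
    regroup = solve-∀

  leg-hook : ∀ {i j t v} → 1 ≤ i → 1 ≤ j → t + i ≤ conj κ j →
    t + row κ i ≡ v + row κ (t + i) → hook κ (t + i , j) + v ≡ hook κ (i , j)
  leg-hook {i} {j} {t} {v} 1≤i 1≤j t+i≤conj reach = +-cancelʳ-≡ (t + i + j) _ _ (begin
    hook κ (t + i , j) + v + (t + i + j)      ≡⟨ regroup (hook κ (t + i , j)) v (t + i) j ⟩
    hook κ (t + i , j) + (t + i + j) + v      ≡⟨ cong (_+ v) (hook+i+j≡row+conj+1 j≤row-t+i t+i≤conj) ⟩
    row κ (t + i) + conj κ j + 1 + v          ≡⟨ regroup′ (row κ (t + i)) (conj κ j) v ⟩
    v + row κ (t + i) + (conj κ j + 1)        ≡⟨ cong (_+ (conj κ j + 1)) reach ⟨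
    t + row κ i + (conj κ j + 1)              ≡⟨ regroup″ t (row κ i) (conj κ j) ⟩
    t + (row κ i + conj κ j + 1)              ≡⟨ cong (t +_) (hook+i+j≡row+conj+1 j≤row i≤conj) ⟨
    t + (hook κ (i , j) + (i + j))            ≡⟨ regroup‴ t (hook κ (i , j)) i j ⟩
    hook κ (i , j) + (t + i + j)              ∎)
    where
    open ≡-Reasoning
    i≤conj = ≤-trans (m≤n+m i t) t+i≤conj
    j≤row = ≤-conj⇒≤-row 1≤i 1≤j i≤conj
    j≤row-t+i = ≤-conj⇒≤-row (≤-trans 1≤i (m≤n+m i t)) 1≤j t+i≤conj
    regroup : ∀ h v k j → h + v + (k + j) ≡ h + (k + j) + v
    regroup = solve-∀
    regroup′ : ∀ r c v → r + c + 1 + v ≡ v + r + (c + 1)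
    regroup′ = solve-∀
    regroup″ : ∀ t r c → t + r + (c + 1) ≡ t + (r + c + 1)
    regroup″ = solve-∀
    regroup‴ : ∀ t h i j → t + (h + (i + j)) ≡ h + (t + i + j)
    regroup‴ = solve-∀

  arm-hook : ∀ {i j t v} → 1 ≤ i → suc (t + row κ i) ≤ v + row κ (t + i) →
    v + j < suc t + row κ i → v + row κ (suc t + i) < suc t + row κ i →
    ∃[ c ] j < c × c ≤ row κ i × hook κ (i , c) ≡ v
  arm-hook {i} {j} {t} {v} 1≤i reach v+j< v+row< =
    c , +-cancelˡ-< v j c (subst (v + j <_) (sym v+c≡) v+j<) , c≤rowᵢ ,
    +-cancelʳ-≡ c _ _ (trans (hook-in-column-of-length 1≤i c≤row row<c) (sym v+c≡))
    where
    c = suc t + row κ i ∸ v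
    v+c≡ : v + c ≡ suc t + row κ i
    v+c≡ = m+[n∸m]≡n (≤-trans (m≤m+n v j) (<⇒≤ v+j<))
    c≤row : c ≤ row κ (t + i)
    c≤row = +-cancelˡ-≤ v c _ (subst (_≤ v + row κ (t + i)) (sym v+c≡) reach)
    row<c : row κ (suc t + i) < c
    row<c = +-cancelˡ-< v _ c (subst (v + row κ (suc t + i) <_) (sym v+c≡) v+row<)
    c≤rowᵢ = ≤-trans c≤row (row-antitone 1≤i (m≤n+m i t))

  -- The differences h(i,j) − h(t + i,j) = t + row i − row (t + i) increase strictly with t.
  -- Take the last t with difference ≤ v: either v equals it (a leg hook), or v lies strictly
  -- below the next one and is the hook in row i of the column of height exactly t + i.
  arm-or-leg : ∀ {i j v} → 1 ≤ i → 1 ≤ j → j ≤ row κ i → 1 ≤ v → v < hook κ (i , j) →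
    (∃[ c ] j < c × c ≤ row κ i × hook κ (i , c) ≡ v) ⊎
    (∃[ r ] i < r × r ≤ conj κ j × hook κ (r , j) + v ≡ hook κ (i , j))
  arm-or-leg {i} {j} {v} 1≤i 1≤j j≤row 1≤v v<hook
    with end-of-run (λ t → t + row κ i ≤? v + row κ (t + i)) (conj κ j ∸ i) (m≤n+m (row κ i) v)
  ... | t , t≤b , reach , stop with t + row κ i ≟ v + row κ (t + i)
  ...   | no not-reached = inj₁ (uncurry (arm-hook 1≤i (≤∧≢⇒< reach not-reached)) (next-row-short t≤b stop))
    where
    b = conj κ j ∸ i
    b+i≡conj : b + i ≡ conj κ j
    b+i≡conj = m∸n+n≡m (≤-row⇒≤-conj 1≤i 1≤j j≤row)
    v+j≤ : v + j ≤ b + row κ i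
    v+j≤ = ≤-trans (+-monoˡ-≤ j (s≤s⁻¹ (subst (v <_) (+-comm _ 1) v<hook)))
                   (≤-reflexive (trans (regroup (row κ i ∸ j) b j) (cong (b +_) (m∸n+n≡m j≤row))))
      where
      regroup : ∀ a b j → a + b + j ≡ b + (a + j)
      regroup = solve-∀
    next-row-short : ∀ {t} → t ≤ b → (t < b → ¬ (suc t + row κ i ≤ v + row κ (suc t + i))) →
      v + j < suc t + row κ i × v + row κ (suc t + i) < suc t + row κ i
    next-row-short {t} t≤b stop with m≤n⇒m<n∨m≡n t≤b
    ... | inj₁ t<b = ≤-<-trans (+-monoʳ-≤ v j≤next-row) (≰⇒> (stop t<b)) , ≰⇒> (stop t<b)
      where
      j≤next-row = ≤-conj⇒≤-row (s≤s z≤n) 1≤j (subst (suc t + i ≤_) b+i≡conj (+-monoˡ-≤ i t<b))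
    ... | inj₂ refl = s≤s v+j≤ , <-trans (+-monoʳ-< v row<j) (s≤s v+j≤)
      where
      row<j = conj<⇒row< 1≤j (subst (_< suc b + i) b+i≡conj ≤-refl)
  arm-or-leg {i} {j} {v} 1≤i 1≤j j≤row 1≤v v<hook
      | zero , _ , _ , _ | yes reached = ⊥-elim (<⇒≢ 1≤v (+-cancelʳ-≡ (row κ i) 0 v reached))
  arm-or-leg {i} {j} {v} 1≤i 1≤j j≤row 1≤v v<hook
      | suc s , t≤b , _ , _ | yes reached =
    inj₂ (suc s + i , m<n+m i (s≤s z≤n) , t+i≤conj , leg-hook 1≤i 1≤j t+i≤conj reached)
    where
    t+i≤conj = subst (suc s + i ≤_) (m∸n+n≡m (≤-row⇒≤-conj 1≤i 1≤j j≤row)) (+-monoˡ-≤ i t≤b)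

  ∈-cells⁺ : ∀ {i j} → 1 ≤ j → j ≤ row κ i → (i , j) ∈ cells κ
  ∈-cells⁺ {i} {j} 1≤j j≤row = ∈.∈-concatMap⁺ _ (lose (∈-oneTo⁺ 1≤i i≤nrows) (∈.∈-map⁺ (i ,_) (∈-oneTo⁺ 1≤j j≤row)))
    where
    1≤i×i≤nrows = row-pos (≤-trans 1≤j j≤row)
    1≤i = proj₁ 1≤i×i≤nrows
    i≤nrows = proj₂ 1≤i×i≤nrows

  rowHooks : ℕ → List ℕ
  rowHooks i = map (λ j → hook κ (i , j)) (oneTo (row κ i))

  ∈-rowHooks⁺ : ∀ {i j} → 1 ≤ j → j ≤ row κ i → hook κ (i , j) ∈ rowHooks i
  ∈-rowHooks⁺ 1≤j j≤row = ∈.∈-map⁺ _ (∈-oneTo⁺ 1≤j j≤row)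

  ∈-rowHooks⁻ : ∀ {i x} → x ∈ rowHooks i → ∃[ j ] (1 ≤ j × j ≤ row κ i) × x ≡ hook κ (i , j)
  ∈-rowHooks⁻ x∈ with j , j∈ , x≡ ← ∈.∈-map⁻ _ x∈ = j , ∈-oneTo⁻ j∈ , x≡

  rowHooks-decreasing : ∀ i → AllPairs _>_ (rowHooks i)
  rowHooks-decreasing i = AllPairs.map⁺ (AllPairs.map⁺ (AllPairs.applyUpTo⁺₁ _ (row κ i)
    λ j<j' j'<row → hook-strictly-decreasing-in-row (s≤s z≤n) (s≤s j<j') j'<row))

  +p∈rowHooks-1⇔+p∈rowHooks : ∀ {i j p} → 1 ≤ i → 1 ≤ j → j ≤ row κ i →
    (hook κ (1 , j) + p ∈ rowHooks 1 → hook κ (i , j) + p ∈ rowHooks i) ×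
    (hook κ (i , j) + p ∈ rowHooks i → hook κ (1 , j) + p ∈ rowHooks 1)
  +p∈rowHooks-1⇔+p∈rowHooks {i} {j} {p} 1≤i 1≤j j≤row = to , from
    where
    down : ∀ {j'} → 1 ≤ j' → j' ≤ row κ i →
      hook κ (1 , j) + p ≡ hook κ (1 , j') → hook κ (i , j) + p ≡ hook κ (i , j')
    down {j'} 1≤j' j'≤row = offset-transfer (hook κ (1 , j)) (hook κ (i , j)) (hook κ (1 , j')) (hook κ (i , j'))
      (hook-first-row-shift 1≤i 1≤j j≤row) (hook-first-row-shift 1≤i 1≤j' j'≤row)
    up : ∀ {j'} → 1 ≤ j' → j' ≤ row κ i →
      hook κ (i , j) + p ≡ hook κ (i , j') → hook κ (1 , j) + p ≡ hook κ (1 , j')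
    up {j'} 1≤j' j'≤row = offset-transfer (hook κ (i , j)) (hook κ (1 , j)) (hook κ (i , j')) (hook κ (1 , j'))
      (sym (hook-first-row-shift 1≤i 1≤j j≤row)) (sym (hook-first-row-shift 1≤i 1≤j' j'≤row))
    to : hook κ (1 , j) + p ∈ rowHooks 1 → hook κ (i , j) + p ∈ rowHooks i
    to ∈₁ with j' , (1≤j' , j'≤row₁) , ≡hook ← ∈-rowHooks⁻ ∈₁ with j' ≤? j
    ... | yes j'≤j = subst (_∈ rowHooks i)
            (sym (down 1≤j' j'≤row ≡hook))
            (∈-rowHooks⁺ 1≤j' j'≤row)
      where j'≤row = ≤-trans j'≤j j≤row
    ... | no j'≰j = ⊥-elim (<⇒≱ (hook-strictly-decreasing-in-row 1≤j (≰⇒> j'≰j) j'≤row₁)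
            (≤-trans (m≤m+n _ p) (≤-reflexive ≡hook)))
    from : hook κ (i , j) + p ∈ rowHooks i → hook κ (1 , j) + p ∈ rowHooks 1
    from ∈ᵢ with j' , (1≤j' , j'≤row) , ≡hook ← ∈-rowHooks⁻ ∈ᵢ =
      subst (_∈ rowHooks 1)
        (sym (up 1≤j' j'≤row ≡hook))
        (∈-rowHooks⁺ 1≤j' (≤-trans j'≤row (row-antitone (s≤s z≤n) 1≤i)))

  module _ {p : ℕ} (p>0 : p > 0) (p-core : All (λ c → hook κ c ≢ p) (cells κ)) where

    hook≢p : ∀ {i j} → 1 ≤ j → j ≤ row κ i → hook κ (i , j) ≢ p
    hook≢p 1≤j j≤row = All.lookup p-core (∈-cells⁺ 1≤j j≤row)

    p∉rowHooks : ∀ i → p ∉ rowHooks i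
    p∉rowHooks i p∈ with _ , (1≤j , j≤row) , p≡hook ← ∈-rowHooks⁻ p∈ = hook≢p 1≤j j≤row (sym p≡hook)

    rowHooks-∸-closed : ∀ {i x} → x ∈ rowHooks i → p < x → x ∸ p ∈ rowHooks i
    rowHooks-∸-closed {i} {x} x∈ p<x
      with j , (1≤j , j≤row) , refl ← ∈-rowHooks⁻ x∈
      with arm-or-leg (row-index-pos 1≤j j≤row) 1≤j j≤row (m<n⇒0<n∸m p<x) (∸-monoʳ-< p>0 (<⇒≤ p<x))
    ... | inj₁ (c , j<c , c≤row , hook≡) = subst (_∈ rowHooks i) hook≡ (∈-rowHooks⁺ (≤-trans 1≤j (<⇒≤ j<c)) c≤row)
    ... | inj₂ (r , i<r , r≤conj , hook+≡) = ⊥-elim (hook≢p 1≤j (≤-conj⇒≤-row (≤-trans (s≤s z≤n) i<r) 1≤j r≤conj)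
            (+-cancelʳ-≡ (x ∸ p) _ p (trans hook+≡ (sym (m+[n∸m]≡n (<⇒≤ p<x))))))

    count-hook<p≡count-pCol : ∀ i →
      count (λ j → hook κ (i , j) <? p) (oneTo (row κ i)) ≡ count (isPCol? p κ) (oneTo (row κ i))
    count-hook<p≡count-pCol i = begin
      count ((_<? p) ∘ H) js       ≡⟨ count-map (_<? p) H js ⟨
      count (_<? p) (rowHooks i)   ≡⟨ count-<≡count-+∉ p>0 (rowHooks-decreasing i) (p∉rowHooks i) rowHooks-∸-closed ⟩
      count top? (rowHooks i)      ≡⟨ count-map top? H js ⟩
      count (top? ∘ H) js          ≡⟨ count-cong (top? ∘ H) (isPCol? p κ) js (All.tabulate top⇔pCol) ⟩
      count (isPCol? p κ) js       ∎
      where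
      open ≡-Reasoning
      js = oneTo (row κ i)
      H = λ j → hook κ (i , j)
      top? = λ x → x + p ℕ∈.∉? rowHooks i
      top⇔pCol : ∀ {j} → j ∈ js → (H j + p ∉ rowHooks i → IsPCol p κ j) × (IsPCol p κ j → H j + p ∉ rowHooks i)
      top⇔pCol j∈ with 1≤j , j≤row ← ∈-oneTo⁻ j∈
        with to , from ← +p∈rowHooks-1⇔+p∈rowHooks (row-index-pos 1≤j j≤row) 1≤j j≤row
        = (λ ∉ᵢ → ∉ᵢ ∘ to) , (λ ∉₁ → ∉₁ ∘ from)

proposition1p4 : (n p : ℕ) → 0 < n → 0 < p → (κ : Partition) → IsCore n p κ →
    skl n p κ ≡ length (Hnp n p κ)
proposition1p4 n p _ p>0 κ core = begin
  skl n p κ                   ≡⟨ count-concatMap-cong nRow-<p? nRow-pCol? rowCells (oneTo (nrows κ))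
                                   (All.tabulate λ {i} _ → same-count-in-row i) ⟩
  count nRow-pCol? (cells κ)  ≡⟨ List.length-map (hook κ) (filter nRow-pCol? (cells κ)) ⟨
  length (Hnp n p κ)          ∎
  where
  open ≡-Reasoning
  open Diagram κ
  nRow-<p? : Decidable (λ c → IsNRow n κ (proj₁ c) × hook κ c < p)
  nRow-<p? c = isNRow? n κ (proj₁ c) ×-dec (hook κ c <? p)
  nRow-pCol? : Decidable (λ c → IsNRow n κ (proj₁ c) × IsPCol p κ (proj₂ c))
  nRow-pCol? c = isNRow? n κ (proj₁ c) ×-dec isPCol? p κ (proj₂ c)
  rowCells : ℕ → List (ℕ × ℕ)
  rowCells i = map (i ,_) (oneTo (row κ i))
  same-count-in-row : ∀ i → count nRow-<p? (rowCells i) ≡ count nRow-pCol? (rowCells i)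
  same-count-in-row i = begin
    count nRow-<p? (rowCells i)                                 ≡⟨ count-map nRow-<p? (i ,_) js ⟩
    count (λ j → isNRow? n κ i ×-dec (hook κ (i , j) <? p)) js  ≡⟨ count-guard-cong (isNRow? n κ i) _ (isPCol? p κ) js
                                                                     (count-hook<p≡count-pCol p>0 (All.map proj₂ core) i) ⟩
    count (λ j → isNRow? n κ i ×-dec isPCol? p κ j) js          ≡⟨ count-map nRow-pCol? (i ,_) js ⟨
    count nRow-pCol? (rowCells i)                               ∎
    where js = oneTo (row κ i)
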